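{- Let $\mathbf{Q}=(Q,\leq,i)$ be a finite involutive poset and let $x$ be a minimal element of $(Q,\leq)$. Then the class $V=\{u\colon\mathbf{P}\to\mathbf{Q}\in U_{\mathcal{M}}(\mathbf{Q})\mid x\in u(P)\}$ is a directed upset of the preordered class $U_{\mathcal{M}}(\mathbf{Q})$.
   Context: A finite involutive poset is $(P,\leq,i)$ with $(P,\leq)$ a finite poset and $i\colon P\to P$ satisfying $x\leq y\Rightarrow i(y)\leq i(x)$ and $i(i(x))=x$; morphisms are monotone maps commuting with the involutions. For $(P,\leq,i)$: $(M_1)$ $(P,\leq)$ is a nonempty lattice; $(M_2)$ every $x$ with $x\leq i(x)$ has some $y$ with $x\leq y=i(y)$; $(M_3)$ $S=\{x\in P\mid x\leq i(x)\}$ with inherited order is $3$-complete (whenever $X\subseteq S$ is such that every $Y\subseteq X$ with $|Y|<3$ has an upper bound in $S$, $\bigvee X$ exists in $S$). A (De Morgan) unifier for $\mathbf{Q}$ is a morphism $u\colon\mathbf{P}\to\mathbf{Q}$ of finite involutive posets where $\mathbf{P}$ satisfies $(M_1),(M_2),(M_3)$; $u_2\leq u_1$ iff $u_1\circ f=u_2$ for some morphism $f$ between their domains; $U_{\mathcal{M}}(\mathbf{Q})$ is this preordered class. A subclass is an upset if it is closed upward under $\leq$, and directed if any two of its elements have a common upper bound in it. -}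

module Defs where

open import Data.Nat using (ℕ; _<_)
open import Data.Bool using (Bool; T)
open import Data.Fin using (Fin)
open import Data.Fin.Subset using (Subset; _∈_; _⊆_; ∣_∣)
open import Data.Product using (Σ; _×_; ∃; ∃-syntax)
open import Relation.Binary.PropositionalEquality using (_≡_)

-- A finite involutive poset.  The carrier is Fin n (every finite poset is
-- isomorphic to one of this form); the order is given by a Boolean-valued
-- (hence decidable) relation.
record FIPoset : Set where
  field
    size   : ℕ
    le     : Fin size → Fin size → Bool
    ≤-refl    : ∀ x → T (le x x)
    ≤-antisym : ∀ x y → T (le x y) → T (le y x) → x ≡ y
    ≤-trans   : ∀ x y z → T (le x y) → T (le y z) → T (le x z)
    inv       : Fin size → Fin size
    inv-anti  : ∀ x y → T (le x y) → T (le (inv y) (inv x))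
    inv-invol : ∀ x → inv (inv x) ≡ x

  Carrier : Set
  Carrier = Fin size

  _≤_ : Carrier → Carrier → Set
  x ≤ y = T (le x y)

record Morphism (P Q : FIPoset) : Set where
  private
    module P = FIPoset P
    module Q = FIPoset Q
  field
    fun      : P.Carrier → Q.Carrier
    monotone : ∀ x y → x P.≤ y → fun x Q.≤ fun y
    inv-comm : ∀ x → fun (P.inv x) ≡ Q.inv (fun x)

open Morphism public

module _ (P : FIPoset) where
  open FIPoset P hiding (Carrier)
  private
    Carrier = FIPoset.Carrier P

  IsJoin : Carrier → Carrier → Carrier → Set
  IsJoin x y z = x ≤ z × y ≤ z × (∀ w → x ≤ w → y ≤ w → z ≤ w)

  IsMeet : Carrier → Carrier → Carrier → Set
  IsMeet x y z = z ≤ x × z ≤ y × (∀ w → w ≤ x → w ≤ y → w ≤ z)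

  M1 : Set
  M1 = Carrier
     × (∀ x y → ∃[ z ] IsJoin x y z)
     × (∀ x y → ∃[ z ] IsMeet x y z)

  M2 : Set
  M2 = ∀ x → x ≤ inv x → ∃[ y ] (x ≤ y × inv y ≡ y)

  InS : Carrier → Set
  InS x = x ≤ inv x

  HasUBinS : Subset size → Set
  HasUBinS Y = ∃[ s ] (InS s × (∀ y → y ∈ Y → y ≤ s))

  HasJoinInS : Subset size → Set
  HasJoinInS X = ∃[ s ] (InS s × (∀ x → x ∈ X → x ≤ s)
                   × (∀ t → InS t → (∀ x → x ∈ X → x ≤ t) → s ≤ t))

  M3 : Set
  M3 = ∀ (X : Subset size) → (∀ x → x ∈ X → InS x)
     → (∀ (Y : Subset size) → Y ⊆ X → ∣ Y ∣ < 3 → HasUBinS Y)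
     → HasJoinInS X

record Unifier (Q : FIPoset) : Set where
  field
    dom : FIPoset
    m1  : M1 dom
    m2  : M2 dom
    m3  : M3 dom
    map : Morphism dom Q

open Unifier public

_≼_ : {Q : FIPoset} → Unifier Q → Unifier Q → Set
u₂ ≼ u₁ = Σ (Morphism (dom u₂) (dom u₁))
            (λ f → ∀ p → fun (map u₁) (fun f p) ≡ fun (map u₂) p)

IsUpset : {Q : FIPoset} → (Unifier Q → Set) → Set
IsUpset {Q} V = ∀ (u v : Unifier Q) → V u → u ≼ v → V v

IsDirected : {Q : FIPoset} → (Unifier Q → Set) → Set
IsDirected {Q} V = ∀ (u v : Unifier Q) → V u → V v
                 → ∃[ w ] (V w × u ≼ w × v ≼ w)

IsMinimal : (Q : FIPoset) → FIPoset.Carrier Q → Set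
IsMinimal Q x = ∀ y → FIPoset._≤_ Q y x → y ≡ x

InImage : {Q : FIPoset} → FIPoset.Carrier Q → Unifier Q → Set
InImage x u = ∃[ p ] (fun (map u) p ≡ x)

open FIPoset public using (Carrier)

module Submission where

-- Directed: given such unifiers u : P₁ → Q and v : P₂ → Q, place P₁ and P₂
-- side by side between a new bottom and a new top (the glued sum), with i
-- exchanging bottom and top.  Minimality of x forces both images into the
-- interval [x, i x] (each P is a lattice), so u and v extend to the glued sum
-- by bottom ↦ x, top ↦ i x; the summand inclusions witness u, v ≼ this map,
-- and bottom is sent to x.  The work is in showing that the glued sum again
-- satisfies (M1)-(M3).  For (M3) we first rephrase 3-completeness in terms of
-- pairs (subsets of size < 3 are covered by two of their elements), observe
-- that a pairwise bounded subset of S meets at most one summand, and transfer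
-- joins from that summand along an upward-closed embedding.

open import Defs
open import Data.Product using (_×_; _,_; ∃; ∃-syntax; proj₁; proj₂)
open import Data.Nat as ℕ using (ℕ; zero; suc; _+_; _<_; s≤s; z≤n; s≤s⁻¹)
open import Data.Nat.Properties using (+-suc; <-≤-trans; n≤1+n; n≮0; +-monoʳ-≤)
import Data.Nat.Properties as ℕₚ
open import Data.Bool using (Bool; true; false; T)
open import Data.Unit using (tt)
open import Data.Fin using (Fin; zero; suc; _≟_; _↑ˡ_; _↑ʳ_; splitAt)
open import Data.Fin.Properties using (splitAt-↑ˡ; splitAt-↑ʳ; splitAt⁻¹-↑ˡ; splitAt⁻¹-↑ʳ; any?)
open import Data.Fin.Subset using (Subset; _∈_; _⊆_; ∣_∣; ⁅_⁆; _∪_; _-_; Empty; Nonempty; inside; outside)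
open import Data.Fin.Subset.Properties
  using (_∈?_; nonempty?; x∈p⇒∣p-x∣<∣p∣; x∈p⇒p-x⊂p; x∈p∧x≢y⇒x∈p-y; x∈p∪q⁺; x∈p∪q⁻; x∈⁅x⁆; x∈⁅y⁆⇒x≡y; ∣⁅x⁆∣≡1)
open import Data.Vec using ([]; _∷_; lookup; tabulate)
open import Data.Vec.Properties using (lookup∘tabulate; []=⇒lookup; lookup⇒[]=)
open import Data.Sum using (_⊎_; inj₁; inj₂; [_,_]′)
open import Data.Empty using (⊥-elim)
open import Function using (_∘_)
open import Relation.Nullary using (¬_; Dec; yes; no)
open import Relation.Binary.PropositionalEquality using (_≡_; refl; sym; trans; subst; subst₂; cong; cong₂)

module _ (P : FIPoset) where
  open FIPoset P hiding (Carrier)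

  inv-flipˡ : ∀ {a b} → inv a ≤ b → inv b ≤ a
  inv-flipˡ {a} {b} p = subst (λ c → inv b ≤ c) (inv-invol a) (inv-anti _ _ p)

  inv-flipʳ : ∀ {a b} → a ≤ inv b → b ≤ inv a
  inv-flipʳ {a} {b} p = subst (λ c → c ≤ inv a) (inv-invol b) (inv-anti _ _ p)

  -- The involution turns joins into meets, x ∧ y = i (i x ∨ i y);
  -- so for (M1) only joins have to be constructed.
  joins⇒meets : (∀ x y → ∃[ z ] IsJoin P x y z) → ∀ x y → ∃[ z ] IsMeet P x y z
  joins⇒meets joins x y with joins (inv x) (inv y)
  ... | z , ix≤z , iy≤z , least =
    inv z , inv-flipˡ ix≤z , inv-flipˡ iy≤z ,
    λ w w≤x w≤y → inv-flipʳ (least (inv w) (inv-anti _ _ w≤x) (inv-anti _ _ w≤y))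

  -- In a nonempty lattice satisfying (M2) the involution has a fixed point:
  -- m = a ∧ i a satisfies m ≤ i m, and (M2) lifts m to a fixed point.
  fixed-point : M1 P → M2 P → ∃[ y ] inv y ≡ y
  fixed-point (a , _ , meets) m2 with meets a (inv a)
  ... | m , m≤a , m≤ia , _ with m2 m (≤-trans _ _ _ m≤a (inv-flipʳ m≤ia))
  ...   | y , _ , iy≡y = y , iy≡y

-- Subsets of cardinality below 1, 2 and 3 are covered by 0, 1 and 2 of their
-- elements.  This turns the "3-completeness" hypothesis of (M3) into a
-- statement about pairs.
module _ {n : ℕ} where

  card<1⇒empty : (Y : Subset n) → ∣ Y ∣ < 1 → Empty Y
  card<1⇒empty Y ∣Y∣<1 (y , y∈Y) = n≮0 (<-≤-trans (x∈p⇒∣p-x∣<∣p∣ y∈Y) (s≤s⁻¹ ∣Y∣<1))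

  only-element : ∀ {Y : Subset n} {c} → Empty (Y - c) → ∀ {y} → y ∈ Y → y ≡ c
  only-element {c = c} empty {y} y∈Y with y ≟ c
  ... | yes y≡c = y≡c
  ... | no y≢c = ⊥-elim (empty (y , x∈p∧x≢y⇒x∈p-y y∈Y y≢c))

  card<2⇒single : (Y : Subset n) → ∣ Y ∣ < 2
                → Empty Y ⊎ ∃[ c ] (c ∈ Y × (∀ {y} → y ∈ Y → y ≡ c))
  card<2⇒single Y ∣Y∣<2 with nonempty? Y
  ... | no empty = inj₁ empty
  ... | yes (c , c∈Y) = inj₂ (c , c∈Y , only-element
          (card<1⇒empty (Y - c) (<-≤-trans (x∈p⇒∣p-x∣<∣p∣ c∈Y) (s≤s⁻¹ ∣Y∣<2))))

  card<3⇒pair : (Y : Subset n) → ∣ Y ∣ < 3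
              → Empty Y ⊎ ∃[ c ] ∃[ d ] (c ∈ Y × d ∈ Y × (∀ {y} → y ∈ Y → y ≡ c ⊎ y ≡ d))
  card<3⇒pair Y ∣Y∣<3 with nonempty? Y
  ... | no empty = inj₁ empty
  ... | yes (c , c∈Y) with card<2⇒single (Y - c) (<-≤-trans (x∈p⇒∣p-x∣<∣p∣ c∈Y) (s≤s⁻¹ ∣Y∣<3))
  ...   | inj₁ empty = inj₂ (c , c , c∈Y , c∈Y , inj₁ ∘ only-element empty)
  ...   | inj₂ (d , d∈Y-c , only-d) = inj₂ (c , d , c∈Y , proj₁ (x∈p⇒p-x⊂p c∈Y) d∈Y-c , c-or-d)
    where
    c-or-d : ∀ {y} → y ∈ Y → y ≡ c ⊎ y ≡ d
    c-or-d {y} y∈Y with y ≟ c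
    ... | yes y≡c = inj₁ y≡c
    ... | no y≢c = inj₂ (only-d (x∈p∧x≢y⇒x∈p-y y∈Y y≢c))

∣p∪q∣≤∣p∣+∣q∣ : ∀ {n} (p q : Subset n) → ∣ p ∪ q ∣ ℕ.≤ ∣ p ∣ + ∣ q ∣
∣p∪q∣≤∣p∣+∣q∣ []            []            = z≤n
∣p∪q∣≤∣p∣+∣q∣ (outside ∷ p) (outside ∷ q) = ∣p∪q∣≤∣p∣+∣q∣ p q
∣p∪q∣≤∣p∣+∣q∣ (inside  ∷ p) (outside ∷ q) = s≤s (∣p∪q∣≤∣p∣+∣q∣ p q)
∣p∪q∣≤∣p∣+∣q∣ (outside ∷ p) (inside  ∷ q) =
  subst (suc ∣ p ∪ q ∣ ℕ.≤_) (sym (+-suc ∣ p ∣ ∣ q ∣)) (s≤s (∣p∪q∣≤∣p∣+∣q∣ p q))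
∣p∪q∣≤∣p∣+∣q∣ (inside  ∷ p) (inside  ∷ q) =
  s≤s (ℕₚ.≤-trans (∣p∪q∣≤∣p∣+∣q∣ p q) (+-monoʳ-≤ ∣ p ∣ (n≤1+n ∣ q ∣)))

-- A family X ⊆ S is pairwise bounded if any two of
-- its members have a common upper bound in S; for nonempty X this is exactly
-- the hypothesis of (M3), whose subsets of size < 3 are covered by pairs.
module _ (P : FIPoset) where
  open FIPoset P hiding (Carrier)

  PairBounded : Subset size → Set
  PairBounded X = ∀ {a b} → a ∈ X → b ∈ X → ∃[ s ] (InS P s × a ≤ s × b ≤ s)

  small-bounded⇒pair-bounded : ∀ {X} → (∀ Y → Y ⊆ X → ∣ Y ∣ < 3 → HasUBinS P Y) → PairBounded X
  small-bounded⇒pair-bounded {X} small {a} {b} a∈X b∈X =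
    let s , s∈S , ub = small (⁅ a ⁆ ∪ ⁅ b ⁆) ab⊆X ∣ab∣<3
    in  s , s∈S , ub a (x∈p∪q⁺ (inj₁ (x∈⁅x⁆ a))) , ub b (x∈p∪q⁺ (inj₂ (x∈⁅x⁆ b)))
    where
    ab⊆X : ⁅ a ⁆ ∪ ⁅ b ⁆ ⊆ X
    ab⊆X y∈ab with x∈p∪q⁻ ⁅ a ⁆ ⁅ b ⁆ y∈ab
    ... | inj₁ y∈a = subst (_∈ X) (sym (x∈⁅y⁆⇒x≡y a y∈a)) a∈X
    ... | inj₂ y∈b = subst (_∈ X) (sym (x∈⁅y⁆⇒x≡y b y∈b)) b∈X
    ∣ab∣<3 : ∣ ⁅ a ⁆ ∪ ⁅ b ⁆ ∣ < 3
    ∣ab∣<3 = s≤s (subst (∣ ⁅ a ⁆ ∪ ⁅ b ⁆ ∣ ℕ.≤_) (cong₂ _+_ (∣⁅x⁆∣≡1 a) (∣⁅x⁆∣≡1 b)) (∣p∪q∣≤∣p∣+∣q∣ ⁅ a ⁆ ⁅ b ⁆))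

  pair-bounded⇒small-bounded : ∀ {X} → Nonempty X → PairBounded X
                             → ∀ Y → Y ⊆ X → ∣ Y ∣ < 3 → HasUBinS P Y
  pair-bounded⇒small-bounded (a , a∈X) bounded Y Y⊆X ∣Y∣<3 with card<3⇒pair Y ∣Y∣<3
  ... | inj₁ empty with bounded a∈X a∈X
  ...   | s , s∈S , _ = s , s∈S , λ y y∈Y → ⊥-elim (empty (y , y∈Y))
  pair-bounded⇒small-bounded _ bounded Y Y⊆X _
      | inj₂ (c , d , c∈Y , d∈Y , c-or-d) with bounded (Y⊆X c∈Y) (Y⊆X d∈Y)
  ...   | s , s∈S , c≤s , d≤s = s , s∈S , below-s
    where
    below-s : ∀ y → y ∈ Y → y ≤ s
    below-s y y∈Y with c-or-d y∈Y
    ... | inj₁ refl = c≤s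
    ... | inj₂ refl = d≤s

  M3-pairwise : M3 P → ∀ X → (∀ x → x ∈ X → InS P x) → Nonempty X → PairBounded X → HasJoinInS P X
  M3-pairwise m3 X X⊆S nonempty bounded = m3 X X⊆S (pair-bounded⇒small-bounded nonempty bounded)

preimage : ∀ {m n} → (Fin m → Fin n) → Subset n → Subset m
preimage g X = tabulate (λ c → lookup X (g c))

∈-preimage⁺ : ∀ {m n} {g : Fin m → Fin n} {X c} → g c ∈ X → c ∈ preimage g X
∈-preimage⁺ {g = g} {X} {c} gc∈X =
  lookup⇒[]= c _ (trans (lookup∘tabulate (λ c → lookup X (g c)) c) ([]=⇒lookup gc∈X))

∈-preimage⁻ : ∀ {m n} {g : Fin m → Fin n} {X c} → c ∈ preimage g X → g c ∈ X
∈-preimage⁻ {g = g} {X} {c} c∈g⁻X =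
  lookup⇒[]= (g c) X (trans (sym (lookup∘tabulate (λ c → lookup X (g c)) c)) ([]=⇒lookup c∈g⁻X))

-- If P satisfies (M3), then every pairwise bounded X ⊆ S_W that meets
-- the image of f, and whose other members lie below the whole image, has a
-- join in S_W: the image of the join in S_P of the preimage of X.
module _ {P W : FIPoset} (f : Morphism P W)
         (reflects : ∀ a b → FIPoset._≤_ W (fun f a) (fun f b) → FIPoset._≤_ P a b)
         (up-closed : ∀ a t → FIPoset._≤_ W (fun f a) t → InS W t → ∃[ t′ ] fun f t′ ≡ t)
         where
  private
    module P = FIPoset P
    module W = FIPoset W

  reflects-S : ∀ {a} → InS W (fun f a) → InS P a
  reflects-S {a} fa∈S = reflects a (P.inv a) (subst (fun f a W.≤_) (sym (inv-comm f a)) fa∈S)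

  preserves-S : ∀ {a} → InS P a → InS W (fun f a)
  preserves-S {a} a∈S = subst (fun f a W.≤_) (inv-comm f a) (monotone f a (P.inv a) a∈S)

  preimage-⊆S : ∀ {X} → (∀ j → j ∈ X → InS W j) → ∀ c → c ∈ preimage (fun f) X → InS P c
  preimage-⊆S X⊆S c c∈f⁻X = reflects-S (X⊆S _ (∈-preimage⁻ c∈f⁻X))

  preimage-bounded : ∀ {X} → PairBounded W X → PairBounded P (preimage (fun f) X)
  preimage-bounded bounded c∈f⁻X d∈f⁻X with bounded (∈-preimage⁻ c∈f⁻X) (∈-preimage⁻ d∈f⁻X)
  ... | t , t∈S , fc≤t , fd≤t with up-closed _ t fc≤t t∈S
  ...   | t′ , refl = t′ , reflects-S t∈S , reflects _ _ fc≤t , reflects _ _ fd≤t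

  image-of-join : ∀ {X a} → fun f a ∈ X
                → (∀ j → j ∈ X → (∃[ c ] fun f c ≡ j) ⊎ (∀ c → j W.≤ fun f c))
                → HasJoinInS P (preimage (fun f) X) → HasJoinInS W X
  image-of-join {X} {a} fa∈X image-or-below (s , s∈S , ub , least) =
    fun f s , preserves-S s∈S , ub′ , least′
    where
    ub′ : ∀ j → j ∈ X → j W.≤ fun f s
    ub′ j j∈X with image-or-below j j∈X
    ... | inj₁ (c , refl) = monotone f c s (ub c (∈-preimage⁺ j∈X))
    ... | inj₂ below = below s
    least′ : ∀ t → InS W t → (∀ j → j ∈ X → j W.≤ t) → fun f s W.≤ t
    least′ t t∈S t-ub with up-closed a t (t-ub _ fa∈X) t∈S
    ... | t′ , refl = monotone f s t′ (least t′ (reflects-S t∈S)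
                        (λ c c∈f⁻X → reflects c t′ (t-ub _ (∈-preimage⁻ c∈f⁻X))))

  join-along : M3 P → (X : Subset W.size) → (∀ j → j ∈ X → InS W j) → PairBounded W X
             → (a : Carrier P) → fun f a ∈ X
             → (∀ j → j ∈ X → (∃[ c ] fun f c ≡ j) ⊎ (∀ c → j W.≤ fun f c))
             → HasJoinInS W X
  join-along m3 X X⊆S bounded a fa∈X image-or-below =
    image-of-join fa∈X image-or-below
      (M3-pairwise P m3 (preimage (fun f) X) (preimage-⊆S X⊆S) (a , ∈-preimage⁺ fa∈X) (preimage-bounded bounded))

module _ (Q : FIPoset) (x : Carrier Q) where
  open FIPoset Q hiding (Carrier)

  InInterval : {P : FIPoset} → Morphism P Q → Set
  InInterval {P} f = ∀ a → x ≤ fun f a × fun f a ≤ inv x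

  -- If a unifier reaches the minimal element x, its image lies in [x, i x]:
  -- for any a, the meet of a with a preimage of x is mapped below x, hence
  -- onto x, so x ≤ u a; the upper bound follows by applying i to x ≤ u (i a).
  image-in-interval : IsMinimal Q x → (u : Unifier Q) → InImage x u → InInterval (map u)
  image-in-interval minimal u (p , up≡x) a = x≤ a , inv-flipʳ Q (subst (x ≤_) (inv-comm (map u) a) (x≤ (P.inv a)))
    where
    module P = FIPoset (dom u)
    x≤ : ∀ a → x ≤ fun (map u) a
    x≤ a with proj₂ (proj₂ (m1 u)) p a
    ... | m , m≤p , m≤a , _ = subst (_≤ fun (map u) a) um≡x (monotone (map u) m a m≤a)
      where
      um≡x : fun (map u) m ≡ x
      um≡x = minimal _ (subst (fun (map u) m ≤_) up≡x (monotone (map u) m p m≤p))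

module Glue (P₁ P₂ : FIPoset) where
  private
    module P₁ = FIPoset P₁
    module P₂ = FIPoset P₂

  data Point : Set where
    bot top : Point
    inl : P₁.Carrier → Point
    inr : P₂.Carrier → Point

  leᵖ : Point → Point → Bool
  leᵖ bot     _       = true
  leᵖ top     top     = true
  leᵖ (inl a) top     = true
  leᵖ (inr a) top     = true
  leᵖ (inl a) (inl b) = P₁.le a b
  leᵖ (inr a) (inr b) = P₂.le a b
  leᵖ _       _       = false

  infix 4 _⊑_
  _⊑_ : Point → Point → Set
  e ⊑ e′ = T (leᵖ e e′)

  ⊑-refl : ∀ e → e ⊑ e
  ⊑-refl bot     = tt
  ⊑-refl top     = tt
  ⊑-refl (inl a) = P₁.≤-refl a
  ⊑-refl (inr a) = P₂.≤-refl a

  ⊑-top : ∀ e → e ⊑ top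
  ⊑-top bot     = tt
  ⊑-top top     = tt
  ⊑-top (inl _) = tt
  ⊑-top (inr _) = tt

  ⊑-antisym : ∀ e e′ → e ⊑ e′ → e′ ⊑ e → e ≡ e′
  ⊑-antisym bot     bot     _ _ = refl
  ⊑-antisym top     top     _ _ = refl
  ⊑-antisym (inl a) (inl b) p q = cong inl (P₁.≤-antisym a b p q)
  ⊑-antisym (inr a) (inr b) p q = cong inr (P₂.≤-antisym a b p q)
  ⊑-antisym bot     top     _ ()
  ⊑-antisym bot     (inl _) _ ()
  ⊑-antisym bot     (inr _) _ ()
  ⊑-antisym top     bot     () _
  ⊑-antisym (inl _) bot     () _
  ⊑-antisym (inr _) bot     () _
  ⊑-antisym top     (inl _) () _
  ⊑-antisym top     (inr _) () _
  ⊑-antisym (inl _) top     _ ()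
  ⊑-antisym (inr _) top     _ ()
  ⊑-antisym (inl _) (inr _) () _
  ⊑-antisym (inr _) (inl _) () _

  ⊑-trans : ∀ e₁ e₂ e₃ → e₁ ⊑ e₂ → e₂ ⊑ e₃ → e₁ ⊑ e₃
  ⊑-trans bot     _       _       _ _ = tt
  ⊑-trans e₁      _       top     _ _ = ⊑-top e₁
  ⊑-trans (inl a) (inl b) (inl c) p q = P₁.≤-trans a b c p q
  ⊑-trans (inr a) (inr b) (inr c) p q = P₂.≤-trans a b c p q
  ⊑-trans top     top     bot     _ ()
  ⊑-trans top     top     (inl _) _ ()
  ⊑-trans top     top     (inr _) _ ()
  ⊑-trans (inl _) top     bot     _ ()
  ⊑-trans (inl _) top     (inl _) _ ()
  ⊑-trans (inl _) top     (inr _) _ ()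
  ⊑-trans (inr _) top     bot     _ ()
  ⊑-trans (inr _) top     (inl _) _ ()
  ⊑-trans (inr _) top     (inr _) _ ()
  ⊑-trans (inl _) (inl _) bot     _ ()
  ⊑-trans (inl _) (inl _) (inr _) _ ()
  ⊑-trans (inr _) (inr _) bot     _ ()
  ⊑-trans (inr _) (inr _) (inl _) _ ()
  ⊑-trans top     bot     _       () _
  ⊑-trans top     (inl _) _       () _
  ⊑-trans top     (inr _) _       () _
  ⊑-trans (inl _) bot     _       () _
  ⊑-trans (inl _) (inr _) _       () _
  ⊑-trans (inr _) bot     _       () _
  ⊑-trans (inr _) (inl _) _       () _

  invᵖ : Point → Point
  invᵖ bot     = top
  invᵖ top     = bot
  invᵖ (inl a) = inl (P₁.inv a)
  invᵖ (inr b) = inr (P₂.inv b)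

  invᵖ-invol : ∀ e → invᵖ (invᵖ e) ≡ e
  invᵖ-invol bot     = refl
  invᵖ-invol top     = refl
  invᵖ-invol (inl a) = cong inl (P₁.inv-invol a)
  invᵖ-invol (inr b) = cong inr (P₂.inv-invol b)

  invᵖ-anti : ∀ e e′ → e ⊑ e′ → invᵖ e′ ⊑ invᵖ e
  invᵖ-anti bot     e′      _ = ⊑-top (invᵖ e′)
  invᵖ-anti top     top     _ = tt
  invᵖ-anti (inl _) top     _ = tt
  invᵖ-anti (inr _) top     _ = tt
  invᵖ-anti (inl a) (inl b) p = P₁.inv-anti a b p
  invᵖ-anti (inr a) (inr b) p = P₂.inv-anti a b p
  invᵖ-anti top     bot     ()
  invᵖ-anti top     (inl _) ()
  invᵖ-anti top     (inr _) ()
  invᵖ-anti (inl _) bot     ()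
  invᵖ-anti (inl _) (inr _) ()
  invᵖ-anti (inr _) bot     ()
  invᵖ-anti (inr _) (inl _) ()

  -- Points are encoded in Fin (n₁ + (n₂ + 2)): first P₁, then P₂, then bot, top.
  N = P₁.size + (P₂.size + 2)

  code : Point → Fin N
  code bot     = P₁.size ↑ʳ (P₂.size ↑ʳ zero)
  code top     = P₁.size ↑ʳ (P₂.size ↑ʳ suc zero)
  code (inl a) = a ↑ˡ (P₂.size + 2)
  code (inr b) = P₁.size ↑ʳ (b ↑ˡ 2)

  decode : Fin N → Point
  decode j = [ inl , [ inr , bounds ]′ ∘ splitAt P₂.size ]′ (splitAt P₁.size j)
    where
    bounds : Fin 2 → Point
    bounds zero       = bot
    bounds (suc zero) = top

  decode-code : ∀ e → decode (code e) ≡ e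
  decode-code bot rewrite splitAt-↑ʳ P₁.size (P₂.size + 2) (P₂.size ↑ʳ zero) | splitAt-↑ʳ P₂.size 2 zero = refl
  decode-code top rewrite splitAt-↑ʳ P₁.size (P₂.size + 2) (P₂.size ↑ʳ suc zero) | splitAt-↑ʳ P₂.size 2 (suc zero) = refl
  decode-code (inl a) rewrite splitAt-↑ˡ P₁.size a (P₂.size + 2) = refl
  decode-code (inr b) rewrite splitAt-↑ʳ P₁.size (P₂.size + 2) (b ↑ˡ 2) | splitAt-↑ˡ P₂.size b 2 = refl

  code-decode : ∀ j → code (decode j) ≡ j
  code-decode j with splitAt P₁.size j in eq₁
  ... | inj₁ a = splitAt⁻¹-↑ˡ eq₁
  ... | inj₂ k with splitAt P₂.size k in eq₂
  ...   | inj₁ b          = trans (cong (P₁.size ↑ʳ_) (splitAt⁻¹-↑ˡ eq₂)) (splitAt⁻¹-↑ʳ eq₁)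
  ...   | inj₂ zero       = trans (cong (P₁.size ↑ʳ_) (splitAt⁻¹-↑ʳ eq₂)) (splitAt⁻¹-↑ʳ eq₁)
  ...   | inj₂ (suc zero) = trans (cong (P₁.size ↑ʳ_) (splitAt⁻¹-↑ʳ eq₂)) (splitAt⁻¹-↑ʳ eq₁)

  decode-injective : ∀ {j k} → decode j ≡ decode k → j ≡ k
  decode-injective {j} {k} eq = trans (sym (code-decode j)) (trans (cong code eq) (code-decode k))

  Glued : FIPoset
  Glued = record
    { size      = N
    ; le        = λ j k → leᵖ (decode j) (decode k)
    ; ≤-refl    = λ j → ⊑-refl (decode j)
    ; ≤-antisym = λ j k p q → decode-injective (⊑-antisym _ _ p q)
    ; ≤-trans   = λ i j k → ⊑-trans (decode i) (decode j) (decode k)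
    ; inv       = λ j → code (invᵖ (decode j))
    ; inv-anti  = λ j k p → subst₂ _⊑_ (sym (decode-code (invᵖ (decode k)))) (sym (decode-code (invᵖ (decode j))))
                                  (invᵖ-anti (decode j) (decode k) p)
    ; inv-invol = λ j → trans (cong (code ∘ invᵖ) (decode-code (invᵖ (decode j))))
                             (trans (cong code (invᵖ-invol (decode j))) (code-decode j))
    }

  private
    module W = FIPoset Glued

  code-mono : ∀ {e e′} → e ⊑ e′ → code e W.≤ code e′
  code-mono {e} {e′} = subst₂ _⊑_ (sym (decode-code e)) (sym (decode-code e′))

  code-mono⁻ : ∀ {e e′} → code e W.≤ code e′ → e ⊑ e′
  code-mono⁻ {e} {e′} = subst₂ _⊑_ (decode-code e) (decode-code e′)

  code-≤ : ∀ {e k} → e ⊑ decode k → code e W.≤ k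
  code-≤ {e} {k} = subst (_⊑ decode k) (sym (decode-code e))

  ≤-code : ∀ {j e} → decode j ⊑ e → j W.≤ code e
  ≤-code {j} {e} = subst (decode j ⊑_) (sym (decode-code e))

  ≤-code⁻ : ∀ {j e} → j W.≤ code e → decode j ⊑ e
  ≤-code⁻ {j} {e} = subst (decode j ⊑_) (decode-code e)

  inS-code : ∀ {e} → e ⊑ invᵖ e → InS Glued (code e)
  inS-code {e} p = subst (λ d → code e W.≤ code (invᵖ d)) (sym (decode-code e)) (code-mono {e} {invᵖ e} p)

  ι₁ : Morphism P₁ Glued
  ι₁ = record
    { fun      = code ∘ inl
    ; monotone = λ a b → code-mono {inl a} {inl b}
    ; inv-comm = λ a → cong (code ∘ invᵖ) (sym (decode-code (inl a)))
    }

  ι₂ : Morphism P₂ Glued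
  ι₂ = record
    { fun      = code ∘ inr
    ; monotone = λ a b → code-mono {inr a} {inr b}
    ; inv-comm = λ a → cong (code ∘ invᵖ) (sym (decode-code (inr a)))
    }

  above-both : ∀ {a b} w → inl a ⊑ w → inr b ⊑ w → w ≡ top
  above-both top     _ _  = refl
  above-both bot     () _
  above-both (inl _) _ ()
  above-both (inr _) () _

  module _ (joins₁ : ∀ a b → ∃[ c ] IsJoin P₁ a b c)
           (joins₂ : ∀ a b → ∃[ c ] IsJoin P₂ a b c) where

    IsJoinᵖ : Point → Point → Point → Set
    IsJoinᵖ e e′ z = e ⊑ z × e′ ⊑ z × (∀ w → e ⊑ w → e′ ⊑ w → z ⊑ w)

    top-join : ∀ {a b} → IsJoinᵖ (inl a) (inr b) top
    top-join = tt , tt , λ w p q → subst (top ⊑_) (sym (above-both w p q)) tt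

    joinᵖ : ∀ e e′ → ∃[ z ] IsJoinᵖ e e′ z
    joinᵖ bot     e       = e , tt , ⊑-refl e , λ _ _ q → q
    joinᵖ top     e       = top , tt , ⊑-top e , λ _ p _ → p
    joinᵖ (inl a) bot     = inl a , ⊑-refl (inl a) , tt , λ _ p _ → p
    joinᵖ (inr a) bot     = inr a , ⊑-refl (inr a) , tt , λ _ p _ → p
    joinᵖ (inl a) top     = top , tt , tt , λ _ _ q → q
    joinᵖ (inr a) top     = top , tt , tt , λ _ _ q → q
    joinᵖ (inl a) (inr b) = top , top-join
    joinᵖ (inr a) (inl b) = top , tt , tt , λ w p q → proj₂ (proj₂ top-join) w q p
    joinᵖ (inl a) (inl b) with joins₁ a b
    ... | c , a≤c , b≤c , least = inl c , a≤c , b≤c , lub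
      where
      lub : ∀ w → inl a ⊑ w → inl b ⊑ w → inl c ⊑ w
      lub top     _ _ = tt
      lub (inl w) p q = least w p q
      lub bot     () _
      lub (inr _) () _
    joinᵖ (inr a) (inr b) with joins₂ a b
    ... | c , a≤c , b≤c , least = inr c , a≤c , b≤c , lub
      where
      lub : ∀ w → inr a ⊑ w → inr b ⊑ w → inr c ⊑ w
      lub top     _ _ = tt
      lub (inr w) p q = least w p q
      lub bot     () _
      lub (inl _) () _

    glued-M1 : M1 Glued
    glued-M1 = code bot , joins , joins⇒meets Glued joins
      where
      joins : ∀ j k → ∃[ z ] IsJoin Glued j k z
      joins j k with joinᵖ (decode j) (decode k)
      ... | z , j≤z , k≤z , least = code z , ≤-code {j} {z} j≤z , ≤-code {k} {z} k≤z ,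
                                    λ w p q → code-≤ {z} (least (decode w) p q)

  -- (M2): bot is below a fixed point of P₁; all other elements of S lie in a summand.
  glued-M2 : M2 P₁ → M2 P₂ → ∃[ y ] P₁.inv y ≡ y → M2 Glued
  glued-M2 m2₁ m2₂ (y₀ , iy₀≡y₀) j j∈S with M2ᵖ (decode j) (≤-code⁻ {j} {invᵖ (decode j)} j∈S)
    where
    M2ᵖ : ∀ e → e ⊑ invᵖ e → ∃[ y ] (e ⊑ y × invᵖ y ≡ y)
    M2ᵖ bot     _ = inl y₀ , tt , cong inl iy₀≡y₀
    M2ᵖ top     ()
    M2ᵖ (inl a) a∈S with m2₁ a a∈S
    ... | y , a≤y , iy≡y = inl y , a≤y , cong inl iy≡y
    M2ᵖ (inr b) b∈S with m2₂ b b∈S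
    ... | y , b≤y , iy≡y = inr y , b≤y , cong inr iy≡y
  ... | y , j≤y , iy≡y = code y , ≤-code {j} {y} j≤y , cong code (trans (cong invᵖ (decode-code y)) iy≡y)

  -- The members of S in the glued sum are bot and the images of members of
  -- S₁ and S₂; top is not in S since top ⋢ bot.
  data InSView : Fin N → Set where
    at-bot : InSView (code bot)
    at-inl : ∀ a → InSView (code (inl a))
    at-inr : ∀ b → InSView (code (inr b))

  inS-view : ∀ j → InS Glued j → InSView j
  inS-view j j∈S = subst InSView (code-decode j) (view (decode j) (≤-code⁻ {j} {invᵖ (decode j)} j∈S))
    where
    view : ∀ e → e ⊑ invᵖ e → InSView (code e)
    view bot     _ = at-bot
    view top     ()
    view (inl a) _ = at-inl a
    view (inr b) _ = at-inr b

  separated : ∀ {a b} → ¬ (∃[ s ] (InS Glued s × code (inl a) W.≤ s × code (inr b) W.≤ s))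
  separated {a} {b} (s , s∈S , p , q) with inS-view s s∈S
  ... | at-bot   = code-mono⁻ {inl a} {bot} p
  ... | at-inl c = code-mono⁻ {inr b} {inl c} q
  ... | at-inr c = code-mono⁻ {inl a} {inr c} p

  ι₁-up-closed : ∀ a t → code (inl a) W.≤ t → InS Glued t → ∃[ a′ ] code (inl a′) ≡ t
  ι₁-up-closed a t p t∈S with inS-view t t∈S
  ... | at-bot    = ⊥-elim (code-mono⁻ {inl a} {bot} p)
  ... | at-inl a′ = a′ , refl
  ... | at-inr b  = ⊥-elim (code-mono⁻ {inl a} {inr b} p)

  ι₂-up-closed : ∀ b t → code (inr b) W.≤ t → InS Glued t → ∃[ b′ ] code (inr b′) ≡ t
  ι₂-up-closed b t p t∈S with inS-view t t∈S
  ... | at-bot    = ⊥-elim (code-mono⁻ {inr b} {bot} p)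
  ... | at-inl a  = ⊥-elim (code-mono⁻ {inr b} {inl a} p)
  ... | at-inr b′ = b′ , refl

  only-ι₁ : ∀ {X} → ¬ (∃ λ b → code (inr b) ∈ X) → ∀ j → j ∈ X → InS Glued j
          → (∃[ a ] code (inl a) ≡ j) ⊎ (∀ a → j W.≤ code (inl a))
  only-ι₁ no-inr j j∈X j∈S with inS-view j j∈S
  ... | at-bot   = inj₂ (λ a → code-mono {bot} {inl a} tt)
  ... | at-inl a = inj₁ (a , refl)
  ... | at-inr b = ⊥-elim (no-inr (b , j∈X))

  only-ι₂ : ∀ {X} → ¬ (∃ λ a → code (inl a) ∈ X) → ∀ j → j ∈ X → InS Glued j
          → (∃[ b ] code (inr b) ≡ j) ⊎ (∀ b → j W.≤ code (inr b))
  only-ι₂ no-inl j j∈X j∈S with inS-view j j∈S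
  ... | at-bot   = inj₂ (λ b → code-mono {bot} {inr b} tt)
  ... | at-inl a = ⊥-elim (no-inl (a , j∈X))
  ... | at-inr b = inj₁ (b , refl)

  only-bot : ∀ {X} → ¬ (∃ λ a → code (inl a) ∈ X) → ¬ (∃ λ b → code (inr b) ∈ X)
           → ∀ j → j ∈ X → InS Glued j → j W.≤ code bot
  only-bot no-inl no-inr j j∈X j∈S with inS-view j j∈S
  ... | at-bot   = W.≤-refl (code bot)
  ... | at-inl a = ⊥-elim (no-inl (a , j∈X))
  ... | at-inr b = ⊥-elim (no-inr (b , j∈X))

  glued-M3 : M3 P₁ → M3 P₂ → M3 Glued
  glued-M3 m3₁ m3₂ X X⊆S small = cases (any? (λ a → code (inl a) ∈? X)) (any? (λ b → code (inr b) ∈? X))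
    where
    bounded : PairBounded Glued X
    bounded = small-bounded⇒pair-bounded Glued small
    cases : Dec (∃ λ a → code (inl a) ∈ X) → Dec (∃ λ b → code (inr b) ∈ X) → HasJoinInS Glued X
    cases (yes (a , a∈X)) (yes (b , b∈X)) = ⊥-elim (separated (bounded a∈X b∈X))
    cases (yes (a , a∈X)) (no no-inr) =
      join-along ι₁ (λ a b → code-mono⁻ {inl a} {inl b}) ι₁-up-closed m3₁ X X⊆S bounded a a∈X
                 (λ j j∈X → only-ι₁ no-inr j j∈X (X⊆S j j∈X))
    cases (no no-inl) (yes (b , b∈X)) =
      join-along ι₂ (λ a b → code-mono⁻ {inr a} {inr b}) ι₂-up-closed m3₂ X X⊆S bounded b b∈X
                 (λ j j∈X → only-ι₂ no-inl j j∈X (X⊆S j j∈X))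
    cases (no no-inl) (no no-inr) =
      code bot , inS-code {bot} tt , (λ j j∈X → only-bot no-inl no-inr j j∈X (X⊆S j j∈X)) ,
      λ t _ _ → code-≤ {bot} tt

  module _ {Q : FIPoset} {x : Carrier Q} (x≤ix : FIPoset._≤_ Q x (FIPoset.inv Q x))
           (f₁ : Morphism P₁ Q) (f₂ : Morphism P₂ Q)
           (f₁∈ : InInterval Q x f₁) (f₂∈ : InInterval Q x f₂) where
    private
      module Q = FIPoset Q

    copairᵖ : Point → Q.Carrier
    copairᵖ bot     = x
    copairᵖ top     = Q.inv x
    copairᵖ (inl a) = fun f₁ a
    copairᵖ (inr b) = fun f₂ b

    copairᵖ-mono : ∀ e e′ → e ⊑ e′ → copairᵖ e Q.≤ copairᵖ e′
    copairᵖ-mono bot     bot     _ = Q.≤-refl x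
    copairᵖ-mono bot     top     _ = x≤ix
    copairᵖ-mono bot     (inl a) _ = proj₁ (f₁∈ a)
    copairᵖ-mono bot     (inr b) _ = proj₁ (f₂∈ b)
    copairᵖ-mono top     top     _ = Q.≤-refl (Q.inv x)
    copairᵖ-mono (inl a) top     _ = proj₂ (f₁∈ a)
    copairᵖ-mono (inr b) top     _ = proj₂ (f₂∈ b)
    copairᵖ-mono (inl a) (inl b) p = monotone f₁ a b p
    copairᵖ-mono (inr a) (inr b) p = monotone f₂ a b p
    copairᵖ-mono top     bot     ()
    copairᵖ-mono top     (inl _) ()
    copairᵖ-mono top     (inr _) ()
    copairᵖ-mono (inl _) bot     ()
    copairᵖ-mono (inl _) (inr _) ()
    copairᵖ-mono (inr _) bot     ()
    copairᵖ-mono (inr _) (inl _) ()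

    copairᵖ-inv : ∀ e → copairᵖ (invᵖ e) ≡ Q.inv (copairᵖ e)
    copairᵖ-inv bot     = refl
    copairᵖ-inv top     = sym (Q.inv-invol x)
    copairᵖ-inv (inl a) = inv-comm f₁ a
    copairᵖ-inv (inr b) = inv-comm f₂ b

    copair : Morphism Glued Q
    copair = record
      { fun      = copairᵖ ∘ decode
      ; monotone = λ j k → copairᵖ-mono (decode j) (decode k)
      ; inv-comm = λ j → trans (cong copairᵖ (decode-code (invᵖ (decode j)))) (copairᵖ-inv (decode j))
      }

module Directed (Q : FIPoset) (x : Carrier Q) (minimal : IsMinimal Q x)
                (u v : Unifier Q) (u-hits : InImage x u) (v-hits : InImage x v) where
  open FIPoset Q hiding (Carrier)
  open Glue (dom u) (dom v)

  u∈ : InInterval Q x (map u)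
  u∈ = image-in-interval Q x minimal u u-hits

  v∈ : InInterval Q x (map v)
  v∈ = image-in-interval Q x minimal v v-hits

  x≤ix : x ≤ inv x
  x≤ix = ≤-trans _ _ _ (proj₁ (u∈ (proj₁ u-hits))) (proj₂ (u∈ (proj₁ u-hits)))

  glued : Unifier Q
  glued = record
    { dom = Glued
    ; m1  = glued-M1 (proj₁ (proj₂ (m1 u))) (proj₁ (proj₂ (m1 v)))
    ; m2  = glued-M2 (m2 u) (m2 v) (fixed-point (dom u) (m1 u) (m2 u))
    ; m3  = glued-M3 (m3 u) (m3 v)
    ; map = copair x≤ix (map u) (map v) u∈ v∈
    }

  glued-hits : InImage x glued
  glued-hits = code bot , cong (copairᵖ x≤ix (map u) (map v) u∈ v∈) (decode-code bot)

  u≼glued : u ≼ glued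
  u≼glued = ι₁ , λ a → cong (copairᵖ x≤ix (map u) (map v) u∈ v∈) (decode-code (inl a))

  v≼glued : v ≼ glued
  v≼glued = ι₂ , λ b → cong (copairᵖ x≤ix (map u) (map v) u∈ v∈) (decode-code (inr b))

lemma24 : (Q : FIPoset) (x : Carrier Q) → IsMinimal Q x
        → IsUpset (InImage {Q} x) × IsDirected (InImage {Q} x)
lemma24 Q x minimal = upset , directed
  where
  upset : IsUpset (InImage {Q} x)
  upset u w (p , up≡x) (f , w∘f≡u) = fun f p , trans (w∘f≡u p) up≡x

  directed : IsDirected (InImage {Q} x)
  directed u v u-hits v-hits = glued , glued-hits , u≼glued , v≼glued
    where open Directed Q x minimal u v u-hits v-hits
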